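{- For any types $A, B$ and any function $f : A \to B$, there are functions (1) $\mathsf{adj}\, f \to \mathsf{ish2adj}\, f$, and (2) $\mathsf{adj}\, f \to \mathsf{ish2adjl}\, f$.
   Context: Work in homotopy type theory with univalence and function extensionality. For $f : A \to B$, $f[p]$ denotes $\mathsf{ap}_f\, p$ and $f\llbracket \alpha \rrbracket$ the action of $f$ on a 2-path $\alpha$. $f \sim g$ is $\prod_x fx = gx$. For a homotopy $H : f \sim g$: $H_h :\equiv \lambda c.\,H_{hc}$; $k[H] :\equiv \lambda a.\,k[H_a]$; for $\alpha : H \sim H'$, $k\llbracket\alpha\rrbracket :\equiv \lambda a.\, k\llbracket \alpha_a\rrbracket$. $H \cdot H'$ is pointwise concatenation in diagrammatic order. For $h : X \to Y$, $k : Y \to X$, $H : kh \sim \mathsf{id}_X$, $\mathsf{Coh}\, H : H_{kh} \sim k[h[H]]$ has component at $x$ the naturality path $H_{khx} = (kh)[H_x]$ followed by the functoriality path $(kh)[H_x] = k[h[H_x]]$. Definitions (with $g : B \to A$, $\eta : gf \sim \mathsf{id}_A$, $\varepsilon : fg \sim \mathsf{id}_B$): $\mathsf{adj}\, f :\equiv \sum_{g, \eta, \varepsilon} (f[\eta] \sim \varepsilon_f) \times (\eta_g \sim g[\varepsilon])$; $\mathsf{ish2adj}\, f :\equiv \sum_{g, \eta, \varepsilon} \sum_{\tau : f[\eta] \sim \varepsilon_f} \sum_{\theta : \eta_g \sim g[\varepsilon]} (\mathsf{Coh}\, \eta \cdot g\llbracket \tau \rrbracket \sim \theta_f)$; $\mathsf{ish2adjl}\,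 f :\equiv \sum_{g, \eta, \varepsilon} \sum_{\tau : f[\eta] \sim \varepsilon_f} \sum_{\theta : \eta_g \sim g[\varepsilon]} (\tau_g \cdot \mathsf{Coh}\, \varepsilon \sim f\llbracket \theta \rrbracket)$. -}

{-# OPTIONS --without-K #-}
module Defs where

open import Level using (Level; _⊔_)
open import Data.Product using (Σ; Σ-syntax; _×_)
open import Relation.Binary.PropositionalEquality using (_≡_; refl; sym; trans; cong)

private
  variable
    ℓ ℓ' ℓ'' : Level

-- Homotopies  f ∼ g  :≡  Π x. f x = g x  (for possibly dependent f, g, so that
-- homotopies between homotopies, e.g. α : H ∼ H', are also covered)
infix 4 _∼_
_∼_ : {X : Set ℓ} {Y : X → Set ℓ'} → ((x : X) → Y x) → ((x : X) → Y x) → Set (ℓ ⊔ ℓ')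
f ∼ g = ∀ x → f x ≡ g x

infixr 30 _·_
_·_ : {X : Set ℓ} {Y : X → Set ℓ'} {f g h : (x : X) → Y x} → f ∼ g → g ∼ h → f ∼ h
(H · H') x = trans (H x) (H' x)

-- Action of a function on a path:  k[p] = ap_k p  (= cong k p)
-- Action of a function on a 2-path:  k⟦α⟧ = ap_{ap_k} α  (= cong (cong k) α)

trans-reflʳ : {X : Set ℓ} {x y : X} (p : x ≡ y) → trans p refl ≡ p
trans-reflʳ refl = refl

trans-assoc : {X : Set ℓ} {x y z w : X} (p : x ≡ y) (q : y ≡ z) (r : z ≡ w) →
              trans (trans p q) r ≡ trans p (trans q r)
trans-assoc refl q r = refl

trans-symʳ : {X : Set ℓ} {x y : X} (p : x ≡ y) → trans p (sym p) ≡ refl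
trans-symʳ refl = refl

cancelʳ : {X : Set ℓ} {x y z : X} {a b : x ≡ y} (c : y ≡ z) →
          trans a c ≡ trans b c → a ≡ b
cancelʳ {a = a} {b = b} c e =
  trans (sym (trans (trans-assoc a c (sym c))
                    (trans (cong (trans a) (trans-symʳ c)) (trans-reflʳ a))))
        (trans (cong (λ q → trans q (sym c)) e)
               (trans (trans-assoc b c (sym c))
                      (trans (cong (trans b) (trans-symʳ c)) (trans-reflʳ b))))

nat-id : {X : Set ℓ} {u : X → X} (H : u ∼ (λ x → x)) {x y : X} (p : x ≡ y) →
         trans (H x) p ≡ trans (cong u p) (H y)
nat-id H {x} refl = trans-reflʳ (H x)

cong-∘ : {X : Set ℓ} {Y : Set ℓ'} {Z : Set ℓ''} (k : Y → Z) (h : X → Y)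
         {x y : X} (p : x ≡ y) → cong (λ z → k (h z)) p ≡ cong k (cong h p)
cong-∘ k h refl = refl

naturality : {X : Set ℓ} {Y : Set ℓ'} (h : X → Y) (k : Y → X)
             (H : (λ x → k (h x)) ∼ (λ x → x)) (x : X) →
             H (k (h x)) ≡ cong (λ z → k (h z)) (H x)
naturality h k H x = cancelʳ (H x) (nat-id H (H x))

Coh : {X : Set ℓ} {Y : Set ℓ'} (h : X → Y) (k : Y → X)
      (H : (λ x → k (h x)) ∼ (λ x → x)) →
      (λ x → H (k (h x))) ∼ (λ x → cong k (cong h (H x)))
Coh h k H x = trans (naturality h k H x) (cong-∘ k h (H x))

adj : {A : Set ℓ} {B : Set ℓ'} → (A → B) → Set (ℓ ⊔ ℓ')
adj {A = A} {B = B} f =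
  Σ[ g ∈ (B → A) ] Σ[ η ∈ (λ a → g (f a)) ∼ (λ a → a) ] Σ[ ε ∈ (λ b → f (g b)) ∼ (λ b → b) ]
    ((λ a → cong f (η a)) ∼ (λ a → ε (f a))) × ((λ b → η (g b)) ∼ (λ b → cong g (ε b)))

ish2adj : {A : Set ℓ} {B : Set ℓ'} → (A → B) → Set (ℓ ⊔ ℓ')
ish2adj {A = A} {B = B} f =
  Σ[ g ∈ (B → A) ] Σ[ η ∈ (λ a → g (f a)) ∼ (λ a → a) ] Σ[ ε ∈ (λ b → f (g b)) ∼ (λ b → b) ]
  Σ[ τ ∈ (λ a → cong f (η a)) ∼ (λ a → ε (f a)) ]
  Σ[ θ ∈ (λ b → η (g b)) ∼ (λ b → cong g (ε b)) ]
    ((Coh f g η · (λ a → cong (cong g) (τ a))) ∼ (λ a → θ (f a)))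

ish2adjl : {A : Set ℓ} {B : Set ℓ'} → (A → B) → Set (ℓ ⊔ ℓ')
ish2adjl {A = A} {B = B} f =
  Σ[ g ∈ (B → A) ] Σ[ η ∈ (λ a → g (f a)) ∼ (λ a → a) ] Σ[ ε ∈ (λ b → f (g b)) ∼ (λ b → b) ]
  Σ[ τ ∈ (λ a → cong f (η a)) ∼ (λ a → ε (f a)) ]
  Σ[ θ ∈ (λ b → η (g b)) ∼ (λ b → cong g (ε b)) ]
    (((λ b → τ (g b)) · Coh g f ε) ∼ (λ b → cong (cong f) (θ b)))

{-# OPTIONS --without-K #-}
-- One triangle identity already makes an adjunction a half-adjoint
-- equivalence, and along a half-adjoint equivalence h with
-- inverse k a section of a family P given on the image of h extends to all
-- of Y, as y ↦ transport along ε y of its value at k y, agreeing with the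
-- given section on h (by τ and naturality). So in (1) we forget θ and
-- define the new θ along f as the extension of Coh η · g⟦τ⟧; the required
-- coherence then holds by construction. In (2) we forget τ instead, view
-- (f, ε, η, θ⁻¹) as half-adjoint data for g, and extend f⟦θ⟧ · (Coh ε)⁻¹
-- along g.
module Submission where

open import Level using (Level)
open import Function using (_∘_)
open import Data.Product using (_×_; _,_)
open import Relation.Binary.PropositionalEquality
  using (_≡_; refl; sym; trans; cong; subst; module ≡-Reasoning)
open import Relation.Binary.PropositionalEquality.Properties using (dcong; subst-∘)
open import Defs

private
  variable
    ℓ ℓ' ℓ'' : Level

trans-sym-cancelʳ : {Z : Set ℓ} {a b c : Z} (p : a ≡ b) (q : c ≡ b) →
                    trans (trans p (sym q)) q ≡ p
trans-sym-cancelʳ refl refl = refl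

module HalfAdjointExtension
  {X : Set ℓ} {Y : Set ℓ'} (h : X → Y) (k : Y → X)
  (η : (λ x → k (h x)) ∼ (λ x → x)) (ε : (λ y → h (k y)) ∼ (λ y → y))
  (τ : (λ x → cong h (η x)) ∼ (λ x → ε (h x)))
  (P : Y → Set ℓ'') (s : (x : X) → P (h x)) where

  extend : (y : Y) → P y
  extend y = subst P (ε y) (s (k y))

  extend-β : (x : X) → extend (h x) ≡ s x
  extend-β x = begin
    subst P (ε (h x)) (s (k (h x)))         ≡⟨ cong (λ q → subst P q (s (k (h x)))) (sym (τ x)) ⟩
    subst P (cong h (η x)) (s (k (h x)))    ≡⟨ sym (subst-∘ (η x)) ⟩
    subst (P ∘ h) (η x) (s (k (h x)))       ≡⟨ dcong s (η x) ⟩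
    s x                                     ∎
    where open ≡-Reasoning

open HalfAdjointExtension using (extend; extend-β)

module _ {A : Set ℓ} {B : Set ℓ'} (f : A → B) where

  adj⇒ish2adj : adj f → ish2adj f
  adj⇒ish2adj (g , η , ε , τ , _) =
    g , η , ε , τ , extend f g η ε τ P s , λ a → sym (extend-β f g η ε τ P s a)
    where
    P : B → Set ℓ
    P b = η (g b) ≡ cong g (ε b)

    s : (a : A) → P (f a)
    s = Coh f g η · (λ a → cong (cong g) (τ a))

  adj⇒ish2adjl : adj f → ish2adjl f
  adj⇒ish2adjl (g , η , ε , _ , θ) =
    g , η , ε , τ′ , θ , λ b → begin
      trans (τ′ (g b)) (Coh g f ε b)  ≡⟨ cong (λ q → trans q (Coh g f ε b)) (extend-β g f ε η θ⁻¹ P s b) ⟩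
      trans (s b) (Coh g f ε b)       ≡⟨ trans-sym-cancelʳ (cong (cong f) (θ b)) (Coh g f ε b) ⟩
      cong (cong f) (θ b)             ∎
    where
    open ≡-Reasoning

    θ⁻¹ : (λ b → cong g (ε b)) ∼ (λ b → η (g b))
    θ⁻¹ b = sym (θ b)

    P : A → Set ℓ'
    P a = cong f (η a) ≡ ε (f a)

    s : (b : B) → P (g b)
    s b = trans (cong (cong f) (θ b)) (sym (Coh g f ε b))

    τ′ : (a : A) → P a
    τ′ = extend g f ε η θ⁻¹ P s

corollary3p10 : {ℓ ℓ' : Level} {A : Set ℓ} {B : Set ℓ'} (f : A → B) →
    (adj f → ish2adj f) × (adj f → ish2adjl f)
corollary3p10 f = adj⇒ish2adj f , adj⇒ish2adjl f
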